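{- Let $G$ be an episode and $s$ a sequence over a finite alphabet $\Sigma$. Let $\mathcal{V}$ be any collection of pairwise non-overlapping minimal windows of $G$ in $s$. Then $|\mathcal{V}| \le |\nu(G; s)|$.
   Context: An episode is a directed acyclic graph $G = (V, E, \mathrm{lab})$ with node labeling $\mathrm{lab}: V \to \Sigma$. A sequence $u = u_1 \cdots u_m$ covers $G$ if there is an injective map $f: V \to \{1,\dots,m\}$ such that $u_{f(v)} = \mathrm{lab}(v)$ for all $v \in V$, and $f(v) < f(w)$ for every edge $(v,w) \in E$. For a sequence $s = s_1 \cdots s_L$, a window is a contiguous subsequence $s[i,j] = s_i \cdots s_j$ with $1 \le i \le j \le L$, identified by its index interval $[i,j]$. A window is a minimal window of $G$ in $s$ if it covers $G$ and no proper sub-window of it covers $G$. Two windows overlap if their index intervals intersect. $\nu(G;s)$ is defined greedily. List all minimal windows of $G$ in $s$ in order of their occurrence (by starting index). Select the first window and discard every window that overlaps it. Repeat on the remaining windows until none are left. $\nu(G;s)$ is the collection of selected windows. -}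

module Defs where

open import Data.Nat using (ℕ; zero; suc)
open import Data.Fin using (Fin; _≤_; _<_; _≤?_)
open import Data.Product using (_×_; _,_; Σ; ∃; proj₁; proj₂)
open import Data.List using (List; []; _∷_; filter; length)
open import Data.List.Membership.Propositional using (_∈_)
open import Data.Bool using (Bool)
open import Relation.Nullary using (¬_; Dec)
open import Relation.Nullary.Decidable using (_×-dec_; ¬?)
open import Relation.Binary.PropositionalEquality using (_≡_; _≢_)
open import Relation.Binary.Construct.Closure.Transitive using (TransClosure)
open import Function.Definitions using (Injective)

record Episode (k : ℕ) : Set where
  field
    n       : ℕ
    edges   : List (Fin n × Fin n)
    lab     : Fin n → Fin k
    acyclic : ∀ v → ¬ TransClosure (λ a b → (a , b) ∈ edges) v v
open Episode public

-- A sequence of length L over Fin k; positions are 0-based (Fin L).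
Seq : ℕ → ℕ → Set
Seq k L = Fin L → Fin k

Window : ℕ → Set
Window L = Fin L × Fin L

IsWindow : ∀ {L} → Window L → Set
IsWindow (i , j) = i ≤ j

Covers : ∀ {k L} → Episode k → Seq k L → Window L → Set
Covers {k} {L} G s (i , j) =
  Σ (Fin (n G) → Fin L) λ f →
      Injective _≡_ _≡_ f
    × (∀ v → i ≤ f v × f v ≤ j)
    × (∀ v → s (f v) ≡ lab G v)
    × (∀ {v w} → (v , w) ∈ edges G → f v < f w)

SubWindow : ∀ {L} → Window L → Window L → Set
SubWindow (i' , j') (i , j) = i ≤ i' × j' ≤ j

IsMinimalWindow : ∀ {k L} → Episode k → Seq k L → Window L → Set
IsMinimalWindow G s w =
    IsWindow w
  × Covers G s w
  × (∀ w' → IsWindow w' → SubWindow w' w → w' ≢ w → ¬ Covers G s w')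

Overlap : ∀ {L} → Window L → Window L → Set
Overlap (i₁ , j₁) (i₂ , j₂) = i₁ ≤ j₂ × i₂ ≤ j₁

overlap? : ∀ {L} (w w' : Window L) → Dec (Overlap w w')
overlap? (i₁ , j₁) (i₂ , j₂) = (i₁ ≤? j₂) ×-dec (i₂ ≤? j₁)

-- Greedy selection on a list of windows (already ordered by start index):
-- select the first window, discard all windows overlapping it, repeat.
-- (Recursion is driven by a fuel argument equal to the list length, which
-- suffices since each step removes at least the selected window.)
greedyFuel : ∀ {L} → ℕ → List (Window L) → List (Window L)
greedyFuel zero    _        = []
greedyFuel (suc m) []       = []
greedyFuel (suc m) (w ∷ ws) =
  w ∷ greedyFuel m (filter (λ w' → ¬? (overlap? w w')) ws)

greedy : ∀ {L} → List (Window L) → List (Window L)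
greedy ws = greedyFuel (length ws) ws

start : ∀ {L} → Window L → Fin L
start = proj₁

-- Minimal windows never nest, so among minimal windows the order by start index is also an
-- order by end index. Hence every minimal window that starts no earlier than a minimal
-- window w and overlaps it contains the last position of w, and a family of pairwise
-- non-overlapping minimal windows drawn from those starting at or after w has at most one
-- member overlapping w. The greedy algorithm selects the earliest window w and recurses on
-- the windows disjoint from it, so by induction it selects at least as many windows as any
-- such family.
module Submission where

open import Defs
open import Data.Nat using (ℕ; _≤_; suc; z≤n; s≤s)
import Data.Nat.Properties as ℕ
open import Data.List using (List; []; _∷_; length; filter)
open import Data.List.Properties using (filter-all; filter-accept; filter-reject; length-filter)
open import Data.List.Membership.Propositional using (_∈_)
open import Data.List.Relation.Binary.Subset.Propositional using (_⊆_)
open import Data.List.Relation.Binary.Subset.Propositional.Properties using (filter⁺′)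
open import Data.List.Relation.Unary.All using (All; []; _∷_; lookup; tabulate; zip; zipWith)
import Data.List.Relation.Unary.All.Properties as All
open import Data.List.Relation.Unary.AllPairs using (AllPairs; []; _∷_)
import Data.List.Relation.Unary.AllPairs.Properties as AllPairs
open import Data.List.Relation.Unary.Unique.Propositional using (Unique)
open import Data.Product using (_×_; _,_; proj₁; proj₂)
open import Function using (id; _∘_)
open import Function.Bundles using (_⇔_; Equivalence)
open import Relation.Nullary using (¬_; yes; no; contradiction)
open import Relation.Nullary.Decidable using (¬?)
open import Relation.Unary using (Decidable)
open import Relation.Binary.PropositionalEquality using (refl; cong; sym; subst)
open import Data.List.Relation.Unary.Any using (here)
import Data.Fin as F
import Data.Fin.Properties as F

end : ∀ {L} → Window L → F.Fin L
end = proj₂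

disjoint? : ∀ {L} (w : Window L) → Decidable (λ x → ¬ Overlap w x)
disjoint? w x = ¬? (overlap? w x)

module NonNestedFamily {L : ℕ} (P : Window L → Set)
  (P⇒IsWindow : ∀ {w} → P w → IsWindow w)
  (end-mono : ∀ {w x} → P w → P x → start w F.≤ start x → end w F.≤ end x)
  where

  StartsAfter : Window L → Window L → Set
  StartsAfter w x = P x × start w F.≤ start x

  overlap-refl : ∀ {w} → P w → Overlap w w
  overlap-refl pw = P⇒IsWindow pw , P⇒IsWindow pw

  overlapping-later-windows-overlap : ∀ {w x y} → P w →
    StartsAfter w x → StartsAfter w y → Overlap w x → Overlap w y → Overlap x y
  overlapping-later-windows-overlap pw (px , w≤x) (py , w≤y) (_ , x≤w) (_ , y≤w) =
    F.≤-trans x≤w (end-mono pw py w≤y) , F.≤-trans y≤w (end-mono pw px w≤x)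

  at-most-one-overlaps : ∀ {w} → P w → (V : List (Window L)) →
    All (StartsAfter w) V → AllPairs (λ x y → ¬ Overlap x y) V →
    length V ≤ suc (length (filter (disjoint? w) V))
  at-most-one-overlaps pw [] [] [] = z≤n
  at-most-one-overlaps {w} pw (x ∷ V) (ax ∷ aV) (x#V ∷ #V) with overlap? w x
  ... | yes wx = begin
    suc (length V)                               ≡⟨ cong (suc ∘ length) (filter-all (disjoint? w) V#w) ⟨
    suc (length (filter (disjoint? w) V))        ≡⟨ cong (suc ∘ length) (filter-reject (disjoint? w) (λ w#x → w#x wx)) ⟨
    suc (length (filter (disjoint? w) (x ∷ V)))  ∎
    where
      open ℕ.≤-Reasoning hiding (start)
      V#w : All (λ y → ¬ Overlap w y) V
      V#w = zipWith (λ (ay , x#y) wy →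
                x#y (overlapping-later-windows-overlap pw ax ay wx wy)) (aV , x#V)
  ... | no w#x = begin
    suc (length V)                               ≤⟨ s≤s (at-most-one-overlaps pw V aV #V) ⟩
    suc (suc (length (filter (disjoint? w) V)))  ≡⟨ cong (suc ∘ length) (filter-accept (disjoint? w) w#x) ⟨
    suc (length (filter (disjoint? w) (x ∷ V)))  ∎
    where open ℕ.≤-Reasoning hiding (start)

  greedyFuel-optimal : ∀ m ws → length ws ≤ m →
    AllPairs (λ w x → start w F.≤ start x) ws → All P ws →
    ∀ V → V ⊆ ws → AllPairs (λ x y → ¬ Overlap x y) V →
    length V ≤ length (greedyFuel m ws)
  greedyFuel-optimal m [] _ _ _ [] _ _ = z≤n
  greedyFuel-optimal m [] _ _ _ (v ∷ V) V⊆[] _ with () ← V⊆[] (here refl)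
  greedyFuel-optimal (suc m) (w ∷ ws) (s≤s |ws|≤m) (w≤ws ∷ sorted) (pw ∷ pws) V V⊆ #V =
    begin
      length V                               ≤⟨ at-most-one-overlaps pw V V-after-w #V ⟩
      suc (length (filter (disjoint? w) V))  ≤⟨ s≤s (greedyFuel-optimal m ws′ |ws′|≤m sorted′ pws′ _ V′⊆ws′ #V′) ⟩
      suc (length (greedyFuel m ws′))        ∎
    where
      open ℕ.≤-Reasoning hiding (start)
      ws′ : List (Window L)
      ws′ = filter (disjoint? w) ws
      |ws′|≤m : length ws′ ≤ m
      |ws′|≤m = ℕ.≤-trans (length-filter (disjoint? w) ws) |ws|≤m
      sorted′ : AllPairs (λ w x → start w F.≤ start x) ws′
      sorted′ = AllPairs.filter⁺ (disjoint? w) sorted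
      pws′ : All P ws′
      pws′ = All.filter⁺ (disjoint? w) pws
      V-after-w : All (StartsAfter w) V
      V-after-w = All.anti-mono V⊆ ((pw , F.≤-refl) ∷ zip (pws , w≤ws))
      V′⊆ws′ : filter (disjoint? w) V ⊆ ws′
      V′⊆ws′ = subst (filter (disjoint? w) V ⊆_)
                 (filter-reject (disjoint? w) (λ w#w → w#w (overlap-refl pw)))
                 (filter⁺′ (disjoint? w) (disjoint? w) id V⊆)
      #V′ : AllPairs (λ x y → ¬ Overlap x y) (filter (disjoint? w) V)
      #V′ = AllPairs.filter⁺ (disjoint? w) #V

  greedy-optimal : ∀ ws → AllPairs (λ w x → start w F.≤ start x) ws → All P ws →
    ∀ V → V ⊆ ws → AllPairs (λ x y → ¬ Overlap x y) V →
    length V ≤ length (greedy ws)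
  greedy-optimal ws = greedyFuel-optimal (length ws) ws ℕ.≤-refl

minimal-end-mono : ∀ {k L} {G : Episode k} {s : Seq k L} {w x : Window L} →
  IsMinimalWindow G s w → IsMinimalWindow G s x →
  start w F.≤ start x → end w F.≤ end x
minimal-end-mono {w = w} {x} (_ , _ , w-minimal) (x-window , x-covers , _) sw≤sx
  with end w F.≤? end x
... | yes ew≤ex = ew≤ex
... | no ew≰ex = contradiction x-covers
      (w-minimal x x-window (sw≤sx , ℕ.<⇒≤ ex<ew) (λ x≡w → F.<⇒≢ ex<ew (cong end x≡w)))
  where
    ex<ew : end x F.< end w
    ex<ew = ℕ.≰⇒> ew≰ex

mainTheorem8 : ∀ {k L} (G : Episode k) (s : Seq k L)
    (M : List (Window L)) →
    Unique M →
    (∀ w → w ∈ M ⇔ IsMinimalWindow G s w) →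
    AllPairs (λ w w' → start w F.≤ start w') M →
    (V : List (Window L)) →
    All (IsMinimalWindow G s) V →
    AllPairs (λ w w' → ¬ Overlap w w') V →
    length V ≤ length (greedy M)
mainTheorem8 G s M _ M-minimal sorted V V-minimal V-disjoint =
  greedy-optimal M sorted (tabulate (Equivalence.to (M-minimal _)))
    V (λ v∈V → Equivalence.from (M-minimal _) (lookup V-minimal v∈V)) V-disjoint
  where open NonNestedFamily (IsMinimalWindow G s) proj₁ (minimal-end-mono {G = G} {s})
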